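{- Let $F(m;\,n_1,n_2)$ denote the number of lattice walks from $(0,0)$ to $(n_1,n_2)$ with exactly $m$ steps, each step in $\{(1,0),(-1,0),(1,1),(-1,-1)\}$, always staying in the first quadrant; set $F(m;\,n_1,n_2)=0$ if $m<0$, $n_1<0$ or $n_2<0$. For $m\ge 0$ define $\widetilde F(m;\,n_1,0)=F(m-1;\,n_1,0)$ for $n_1\ge 0$, and $\widetilde F(m;\,0,n_2)=F(m-1;\,0,n_2)+F(m-1;\,0,n_2-1)$ for $n_2\ge 0$ (the two definitions agree at $n_1=n_2=0$). For $i,j\ge 0$ let $$f(i,j)=\begin{cases}\widetilde F(i;\,0,j-i),& i\le j,\\ \widetilde F(j;\,i-j,0),& i\ge j,\end{cases}$$ and $$c(u,v,i,j)=\begin{cases}\displaystyle\binom{ -\min\{i,j\}}{\frac{u-i}{2}}\binom{ -\min\{i,j\}}{v-j-\frac{u-i}{2}}, & i\equiv u \pmod 2,\\[2mm] 0,&\text{otherwise.}\end{cases}$$ Let $\rho:\mathbb{N}\times\mathbb{N}\to\mathbb{N}$ be a bijection that is monotonic in the sense that $\rho(a,b)\le\rho(c,d)$ whenever $a\le c$ and $b\le d$. Define the infinite matrix $\mathbf{A}=[a(n,k)]_{n,k\ge 0}$ and infinite vectors $\mathbf{x}=(x(k))_{k\ge 0}$, $\mathbf{b}=(b(n))_{n\ge0}$ by $a(n,k)=c(u,v,i,j)$, $x(k)=f(i,j)$, and $b(n)=1$ if $(u,v)=(1,1)$ and $b(n)=0$ otherwise, where $(u,v)=\rho^{ -1}(n)$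 and $(i,j)=\rho^{ -1}(k)$. Then (i) $\mathbf{A}$ is lower-triangular with unit diagonal (i.e. $a(n,n)=1$ and $a(n,k)=0$ for $n<k$); (ii) $\mathbf{A}\mathbf{x}=\mathbf{b}$, i.e. for every $n\ge 0$, $\sum_{k\ge 0}a(n,k)\,x(k)=b(n)$ (the sum having only finitely many nonzero terms).
   Context: $\mathbb{N}=\{0,1,2,\dots\}$. For integers $a,k$, $\binom{a}{k}=\frac{a(a-1)\cdots(a-k+1)}{k!}$ if $k\ge 0$ and $\binom{a}{k}=0$ if $k<0$. -}

module Defs where

open import Data.Bool using (Bool; true; false; _∧_; if_then_else_)
open import Data.Nat as ℕ using (ℕ; zero; suc; _!)
open import Data.Nat.Properties using (_!≢0)
open import Data.Integer as ℤ using (ℤ; +_; -[1+_]; _+_; _-_; _*_; -_; ∣_∣)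
import Data.Integer.Properties as ℤP
open import Data.Integer.DivMod using (_/ℕ_)
open import Data.List using (List; []; _∷_; map; concatMap)
open import Data.Product using (_×_; _,_)
open import Relation.Nullary.Decidable using (⌊_⌋)
open import Relation.Nullary using (yes; no)

data Step : Set where
  E W NE SW : Step

stepVec : Step → ℤ × ℤ
stepVec E  = (+ 1 , + 0)
stepVec W  = (ℤ.-1ℤ , + 0)
stepVec NE = (+ 1 , + 1)
stepVec SW = (ℤ.-1ℤ , ℤ.-1ℤ)

move : ℤ × ℤ → Step → ℤ × ℤ
move (x , y) s with stepVec s
... | (dx , dy) = (x + dx , y + dy)

allWalks : ℕ → List (List Step)
allWalks zero    = [] ∷ []
allWalks (suc m) = concatMap (λ w → map (λ s → s ∷ w) (E ∷ W ∷ NE ∷ SW ∷ [])) (allWalks m)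

inQuadrant : ℤ × ℤ → Bool
inQuadrant (x , y) = ⌊ + 0 ℤ.≤? x ⌋ ∧ ⌊ + 0 ℤ.≤? y ⌋

staysFrom : ℤ × ℤ → List Step → Bool
staysFrom p []      = inQuadrant p
staysFrom p (s ∷ w) = inQuadrant p ∧ staysFrom (move p s) w

endFrom : ℤ × ℤ → List Step → ℤ × ℤ
endFrom p []      = p
endFrom p (s ∷ w) = endFrom (move p s) w

samePoint : ℤ × ℤ → ℤ × ℤ → Bool
samePoint (a , b) (c , d) = ⌊ a ℤ.≟ c ⌋ ∧ ⌊ b ℤ.≟ d ⌋

countTrue : {A : Set} → (A → Bool) → List A → ℕ
countTrue p []       = 0
countTrue p (x ∷ xs) = if p x then suc (countTrue p xs) else countTrue p xs

walkCount : ℕ → ℤ → ℤ → ℕ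
walkCount m n₁ n₂ =
  countTrue (λ w → staysFrom (+ 0 , + 0) w ∧ samePoint (endFrom (+ 0 , + 0) w) (n₁ , n₂))
            (allWalks m)

-- F(m; n1, n2) for integer arguments; 0 when m < 0
-- (and automatically 0 when n1 < 0 or n2 < 0, as no such walk exists)
F : ℤ → ℤ → ℤ → ℕ
F (+ m)      n₁ n₂ = walkCount m n₁ n₂
F -[1+ _ ]   n₁ n₂ = 0

Ftilde-x : ℕ → ℕ → ℕ
Ftilde-x m n₁ = F (+ m - + 1) (+ n₁) (+ 0)

Ftilde-y : ℕ → ℕ → ℕ
Ftilde-y m n₂ = F (+ m - + 1) (+ 0) (+ n₂) ℕ.+ F (+ m - + 1) (+ 0) (+ n₂ - + 1)

f : ℕ → ℕ → ℕ
f i j with i ℕ.≤? j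
... | yes _ = Ftilde-y i (j ℕ.∸ i)
... | no _  = Ftilde-x j (i ℕ.∸ j)

falling : ℤ → ℕ → ℤ
falling a zero    = + 1
falling a (suc k) = falling a k * (a - + k)

binom : ℤ → ℤ → ℤ
binom a (+ k)      = (falling a k /ℕ (k !)) {{k !≢0}}
binom a -[1+ _ ]   = + 0

c : ℕ → ℕ → ℕ → ℕ → ℤ
c u v i j with ⌊ (i ℕ.% 2) ℕ.≟ (u ℕ.% 2) ⌋
... | false = + 0
... | true  = binom (- + (i ℕ.⊓ j)) h * binom (- + (i ℕ.⊓ j)) (+ v - + j - h)
  where
  h : ℤ
  h = (+ u - + i) /ℕ 2   -- exact, since u - i is even here

sumTo : ℕ → (ℕ → ℤ) → ℤ
sumTo zero    g = + 0
sumTo (suc N) g = sumTo N g + g N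

bvec : ℕ × ℕ → ℤ
bvec (1 , 1) = + 1
bvec _       = + 0

module Submission where

open import Defs
open import Data.Nat using (ℕ; suc; _≤_; _<_)
open import Data.Integer using (ℤ; +_; _*_)
open import Data.Product using (_×_; _,_; proj₁; proj₂)
open import Function.Bundles using (_↔_; Inverse)
open import Relation.Binary.PropositionalEquality using (_≡_; _≢_)
open import Relation.Nullary using (Dec)

open import Data.Bool using (Bool; true; false; if_then_else_; _∧_)
import Data.Bool.Properties as BoolP
open import Data.Empty using (⊥-elim)
open import Data.Integer as ℤ using (-[1+_]; _+_; _-_; -_)
import Data.Integer.Properties as ℤP
open import Algebra.Properties.AbelianGroup ℤP.+-0-abelianGroup using (∙-cancelʳ)
open import Data.Integer.DivMod using (_/ℕ_; [n/ℕd]*d≤n)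
open import Data.Integer.Tactic.RingSolver using (solve-∀)
open import Data.List using (List; []; _∷_; _++_; map; concatMap)
open import Data.Nat as ℕ using (zero; _!; ⌊_/2⌋)
open import Data.Nat.Tactic.RingSolver using () renaming (solve-∀ to solveℕ)
import Data.Nat.Properties as ℕP
open import Data.Nat.Properties using (_!≢0)
import Data.Nat.DivMod as ℕD
open import Data.Product using (Σ)
open import Data.Sum using (_⊎_; inj₁; inj₂)
open import Relation.Nullary using (yes; no)
open import Relation.Nullary.Decidable using (⌊_⌋)
open import Relation.Binary.PropositionalEquality
  using (refl; sym; trans; cong; cong₂; subst; module ≡-Reasoning)

-- Write E_m(X, Y) for the coefficient of s^X t^Y in ((1 + t)(1 + s²t))^(−m); it equals
-- binom(−m, X/2)·binom(−m, Y − X/2) for even X ≥ 0 and 0 otherwise, so that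
-- c(u,v,i,j) = E_{min(i,j)}(u − i, v − j).  Part (i) follows since E_m(0,0) = 1, E_m is
-- supported in the quadrant, and a monotone ρ lists (i,j) ≤ (u,v) no later than (u,v).
-- For part (ii) fix (u,v) and put G_m(i,j) = F(m; i−m−1, j−m−1) and
-- Φ_m = Σ_{(i,j) ≤ (u,v)} G_m(i,j) E_m(u−i, v−j).  The last-step recurrence for walks fails
-- only on the axes, and its defect there is the boundary value F̃; pairing this with the
-- Pascal rule E_m = E_{m+1}·(1+t)(1+s²t) gives Σ F̃(m+1; i−m−1, j−m−1) E_{m+1}(u−i, v−j)
-- = Φ_m − Φ_{m+1}.  Summing over m telescopes to Φ_0 − Φ_u = b(u,v) − 0, while the left
-- side is Σ c(u,v,i,j) f(i,j), because F̃(m; i−m, j−m) = δ(m, min(i,j)) f(i,j).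

sum-cong< : ∀ N {g h : ℕ → ℤ} → (∀ k → k < N → g k ≡ h k) → sumTo N g ≡ sumTo N h
sum-cong< zero    eq = refl
sum-cong< (suc N) eq =
  cong₂ _+_ (sum-cong< N (λ k k<N → eq k (ℕP.m<n⇒m<1+n k<N))) (eq N (ℕP.n<1+n N))

sum-cong : ∀ N {g h : ℕ → ℤ} → (∀ k → g k ≡ h k) → sumTo N g ≡ sumTo N h
sum-cong N eq = sum-cong< N (λ k _ → eq k)

sum-zero : ∀ N → sumTo N (λ _ → + 0) ≡ + 0
sum-zero zero    = refl
sum-zero (suc N) = cong (_+ + 0) (sum-zero N)

sum-+ : ∀ N (g h : ℕ → ℤ) → sumTo N (λ k → g k + h k) ≡ sumTo N g + sumTo N h
sum-+ zero    g h = refl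
sum-+ (suc N) g h = trans (cong (_+ (g N + h N)) (sum-+ N g h)) (swap-middle (sumTo N g) (sumTo N h) (g N) (h N))
  where
  swap-middle : ∀ a b c d → a + b + (c + d) ≡ a + c + (b + d)
  swap-middle = solve-∀

sum-- : ∀ N (g h : ℕ → ℤ) → sumTo N (λ k → g k - h k) ≡ sumTo N g - sumTo N h
sum-- zero    g h = refl
sum-- (suc N) g h = trans (cong (_+ (g N - h N)) (sum-- N g h)) (regroup (sumTo N g) (sumTo N h) (g N) (h N))
  where
  regroup : ∀ a b c d → a - b + (c - d) ≡ a + c - (b + d)
  regroup = solve-∀

sum-*ˡ : ∀ N a (g : ℕ → ℤ) → sumTo N (λ k → a * g k) ≡ a * sumTo N g
sum-*ˡ zero    a g = sym (ℤP.*-zeroʳ a)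
sum-*ˡ (suc N) a g =
  trans (cong (_+ a * g N) (sum-*ˡ N a g)) (sym (ℤP.*-distribˡ-+ a (sumTo N g) (g N)))

sum-swap : ∀ N M (h : ℕ → ℕ → ℤ) →
  sumTo N (λ k → sumTo M (λ i → h k i)) ≡ sumTo M (λ i → sumTo N (λ k → h k i))
sum-swap zero    M h = sym (sum-zero M)
sum-swap (suc N) M h =
  trans (cong (_+ sumTo M (h N)) (sum-swap N M h)) (sym (sum-+ M (λ i → sumTo N (λ k → h k i)) (h N)))

sum-peel : ∀ n (g : ℕ → ℤ) → sumTo (suc n) g ≡ g 0 + sumTo n (λ k → g (suc k))
sum-peel zero    g = trans (ℤP.+-identityˡ (g 0)) (sym (ℤP.+-identityʳ (g 0)))
sum-peel (suc n) g = trans (cong (_+ g (suc n)) (sum-peel n g)) (ℤP.+-assoc (g 0) _ _)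

opaque
  δ : ℕ → ℕ → ℤ
  δ a b = if ⌊ a ℕ.≟ b ⌋ then + 1 else + 0

  δ-refl : ∀ a → δ a a ≡ + 1
  δ-refl a with a ℕ.≟ a
  ... | yes _ = refl
  ... | no a≢a = ⊥-elim (a≢a refl)

  δ-≢ : ∀ {a b} → a ≢ b → δ a b ≡ + 0
  δ-≢ {a} {b} a≢b with a ℕ.≟ b
  ... | yes a≡b = ⊥-elim (a≢b a≡b)
  ... | no _ = refl

sum-δ-outside : ∀ N k (g : ℕ → ℤ) → N ≤ k → sumTo N (λ m → δ m k * g m) ≡ + 0
sum-δ-outside zero    k g _ = refl
sum-δ-outside (suc N) k g N<k =
  cong₂ _+_ (sum-δ-outside N k g (ℕP.<⇒≤ N<k))
            (cong (_* g N) (δ-≢ (λ N≡k → ℕP.<-irrefl N≡k N<k)))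

sum-δ-inside : ∀ N k (g : ℕ → ℤ) → k < N → sumTo N (λ m → δ m k * g m) ≡ g k
sum-δ-inside (suc N) k g k<1+N with ℕP.m≤n⇒m<n∨m≡n (ℕP.≤-pred k<1+N)
... | inj₁ k<N = begin
    sumTo N (λ m → δ m k * g m) + δ N k * g N
  ≡⟨ cong₂ _+_ (sum-δ-inside N k g k<N) (cong (_* g N) (δ-≢ (λ N≡k → ℕP.<-irrefl (sym N≡k) k<N))) ⟩
    g k + + 0
  ≡⟨ ℤP.+-identityʳ (g k) ⟩
    g k
  ∎
  where open ≡-Reasoning
... | inj₂ refl = begin
    sumTo k (λ m → δ m k * g m) + δ k k * g k
  ≡⟨ cong₂ _+_ (sum-δ-outside k k g ℕP.≤-refl) (cong (_* g k) (δ-refl k)) ⟩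
    + 0 + + 1 * g k
  ≡⟨ trans (ℤP.+-identityˡ _) (ℤP.*-identityˡ (g k)) ⟩
    g k
  ∎
  where open ≡-Reasoning

+-∸-+ : ∀ i d → + (i ℕ.+ d) - + i ≡ + d
+-∸-+ i d = trans (ℤP.m-n≡m⊖n (i ℕ.+ d) i)
                  (trans (ℤP.⊖-≥ (ℕP.m≤m+n i d)) (cong +_ (ℕP.m+n∸m≡n i d)))

+-∸-+suc : ∀ u d → + u - + (u ℕ.+ suc d) ≡ -[1+ d ]
+-∸-+suc u d = trans (ℤP.m-n≡m⊖n u (u ℕ.+ suc d))
                     (trans (ℤP.⊖-< (ℕP.m<m+n u (ℕ.s≤s ℕ.z≤n))) (cong (λ n → - + n) (ℕP.m+n∸m≡n u (suc d))))

neg-minus : ∀ k h → -[1+ k ] - + h ≡ -[1+ (k ℕ.+ h) ]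
neg-minus k zero    = cong -[1+_] (sym (ℕP.+-identityʳ k))
neg-minus k (suc h) = cong -[1+_] (sym (ℕP.+-suc k h))

<⇒negative : ∀ {t q} → t < q → Σ ℕ (λ k → + t - + q ≡ -[1+ k ])
<⇒negative {t} t<q with ℕP.m≤n⇒∃[o]m+o≡n t<q
... | d , refl = d , trans (cong (λ z → + t - + z) (sym (ℕP.+-suc t d))) (+-∸-+suc t d)

shift-sum : ∀ s n (h : ℤ → ℤ) → (∀ k → h -[1+ k ] ≡ + 0) → (∀ t → t < s → h (+ n - + t) ≡ + 0)
  → sumTo (suc n) (λ i → h (+ i - + s)) ≡ sumTo (suc n) (λ i → h (+ i))
shift-sum zero    n h _   _   = sum-cong (suc n) (λ i → cong h (ℤP.+-identityʳ (+ i)))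
shift-sum (suc s) n h neg top = begin
    sumTo (suc n) (λ i → h (+ i - + suc s))
  ≡⟨ sum-cong (suc n) (λ i → cong h (split (+ i) (+ s))) ⟩
    sumTo (suc n) (λ i → h′ (+ i - + s))
  ≡⟨ shift-sum s n h′ neg′ (λ t t<s → trans (cong h (merge (+ n) (+ t))) (top (suc t) (ℕ.s≤s t<s))) ⟩
    sumTo (suc n) (λ i → h (+ i - + 1))
  ≡⟨ sum-peel n (λ i → h (+ i - + 1)) ⟩
    h -[1+ 0 ] + sumTo n (λ i → h (+ i))
  ≡⟨ cong (_+ sumTo n (λ i → h (+ i))) (neg 0) ⟩
    + 0 + sumTo n (λ i → h (+ i))
  ≡⟨ ℤP.+-identityˡ _ ⟩
    sumTo n (λ i → h (+ i))
  ≡⟨ sym (ℤP.+-identityʳ _) ⟩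
    sumTo n (λ i → h (+ i)) + + 0
  ≡⟨ cong (λ z → sumTo n (λ i → h (+ i)) + z) (sym (trans (cong h (sym (ℤP.+-identityʳ (+ n)))) (top 0 (ℕ.s≤s ℕ.z≤n)))) ⟩
    sumTo (suc n) (λ i → h (+ i))
  ∎
  where
  open ≡-Reasoning
  h′ : ℤ → ℤ
  h′ z = h (z - + 1)
  neg′ : ∀ k → h′ -[1+ k ] ≡ + 0
  neg′ k = trans (cong h (neg-minus k 1)) (trans (cong (λ n → h -[1+ n ]) (ℕP.+-comm k 1)) (neg (suc k)))
  split : ∀ i s → i - (+ 1 + s) ≡ i - s - + 1
  split = solve-∀
  merge : ∀ n t → n - t - + 1 ≡ n - (+ 1 + t)
  merge = solve-∀

opaque
  boxSum : ℕ → ℕ → (ℕ → ℕ → ℤ) → ℤ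
  boxSum u v g = sumTo (suc u) (λ i → sumTo (suc v) (λ j → g i j))

  boxSum-def : ∀ u v g → boxSum u v g ≡ sumTo (suc u) (λ i → sumTo (suc v) (λ j → g i j))
  boxSum-def u v g = refl

  boxSum-cong< : ∀ u v {g h : ℕ → ℕ → ℤ} → (∀ i j → i < suc u → j < suc v → g i j ≡ h i j) →
    boxSum u v g ≡ boxSum u v h
  boxSum-cong< u v eq = sum-cong< (suc u) (λ i i≤u → sum-cong< (suc v) (λ j j≤v → eq i j i≤u j≤v))

  boxSum-cong : ∀ u v {g h : ℕ → ℕ → ℤ} → (∀ i j → g i j ≡ h i j) → boxSum u v g ≡ boxSum u v h
  boxSum-cong u v eq = boxSum-cong< u v (λ i j _ _ → eq i j)

  boxSum-zero : ∀ u v → boxSum u v (λ _ _ → + 0) ≡ + 0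
  boxSum-zero u v = trans (sum-cong (suc u) (λ i → sum-zero (suc v))) (sum-zero (suc u))

  boxSum-+ : ∀ u v (g h : ℕ → ℕ → ℤ) → boxSum u v (λ i j → g i j + h i j) ≡ boxSum u v g + boxSum u v h
  boxSum-+ u v g h = trans (sum-cong (suc u) (λ i → sum-+ (suc v) (g i) (h i)))
                           (sum-+ (suc u) (λ i → sumTo (suc v) (g i)) (λ i → sumTo (suc v) (h i)))

  boxSum-- : ∀ u v (g h : ℕ → ℕ → ℤ) → boxSum u v (λ i j → g i j - h i j) ≡ boxSum u v g - boxSum u v h
  boxSum-- u v g h = trans (sum-cong (suc u) (λ i → sum-- (suc v) (g i) (h i)))
                           (sum-- (suc u) (λ i → sumTo (suc v) (g i)) (λ i → sumTo (suc v) (h i)))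

  sum-boxSum-swap : ∀ N u v (h : ℕ → ℕ → ℕ → ℤ) →
    sumTo N (λ k → boxSum u v (h k)) ≡ boxSum u v (λ i j → sumTo N (λ k → h k i j))
  sum-boxSum-swap N u v h =
    trans (sum-swap N (suc u) (λ k i → sumTo (suc v) (h k i)))
          (sum-cong (suc u) (λ i → sum-swap N (suc v) (λ k j → h k i j)))

  boxSum-shift : ∀ u v p q (h : ℤ → ℤ → ℤ) →
    (∀ x k → h x -[1+ k ] ≡ + 0) → (∀ y k → h -[1+ k ] y ≡ + 0) →
    (∀ x t → t < q → h x (+ v - + t) ≡ + 0) → (∀ y t → t < p → h (+ u - + t) y ≡ + 0) →
    boxSum u v (λ i j → h (+ i - + p) (+ j - + q)) ≡ boxSum u v (λ i j → h (+ i) (+ j))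
  boxSum-shift u v p q h negʸ negˣ topʸ topˣ =
    trans (sum-cong (suc u) (λ i → shift-sum q v (h (+ i - + p)) (negʸ _) (topʸ _)))
          (shift-sum p u (λ x → sumTo (suc v) (λ j → h x (+ j)))
            (λ k → trans (sum-cong (suc v) (λ j → negˣ (+ j) k)) (sum-zero (suc v)))
            (λ t t<p → trans (sum-cong (suc v) (λ j → topˣ (+ j) t t<p)) (sum-zero (suc v))))

boxSum-+₄ : ∀ u v (g₁ g₂ g₃ g₄ : ℕ → ℕ → ℤ) →
  boxSum u v (λ i j → g₁ i j + g₂ i j + g₃ i j + g₄ i j)
  ≡ boxSum u v g₁ + boxSum u v g₂ + boxSum u v g₃ + boxSum u v g₄
boxSum-+₄ u v g₁ g₂ g₃ g₄ =
  trans (boxSum-+ u v (λ i j → g₁ i j + g₂ i j + g₃ i j) g₄)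
        (cong (_+ boxSum u v g₄) (trans (boxSum-+ u v (λ i j → g₁ i j + g₂ i j) g₃)
                                        (cong (_+ boxSum u v g₃) (boxSum-+ u v g₁ g₂))))

boxSum-δ : ∀ u v (g : ℕ → ℕ → ℤ) → (∀ i j → u < i ⊎ v < j → g i j ≡ + 0) → ∀ i₀ j₀ →
  boxSum u v (λ i j → (δ i i₀ * δ j j₀) * g i j) ≡ g i₀ j₀
boxSum-δ u v g outside i₀ j₀ =
  trans (boxSum-def u v _)
  (trans (sum-cong (suc u) (λ i → trans (sum-cong (suc v) (λ j → ℤP.*-assoc (δ i i₀) (δ j j₀) (g i j)))
                                        (sum-*ˡ (suc v) (δ i i₀) (λ j → δ j j₀ * g i j))))
         (evaluate (i₀ ℕ.<? suc u) (j₀ ℕ.<? suc v)))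
  where
  evaluate : Dec (i₀ < suc u) → Dec (j₀ < suc v) →
    sumTo (suc u) (λ i → δ i i₀ * sumTo (suc v) (λ j → δ j j₀ * g i j)) ≡ g i₀ j₀
  evaluate (yes i₀≤u) (yes j₀≤v) = trans (sum-δ-inside (suc u) i₀ _ i₀≤u) (sum-δ-inside (suc v) j₀ (g i₀) j₀≤v)
  evaluate (no i₀>u)  _          =
    trans (sum-δ-outside (suc u) i₀ _ (ℕP.≮⇒≥ i₀>u)) (sym (outside i₀ j₀ (inj₁ (ℕP.≮⇒≥ i₀>u))))
  evaluate (yes i₀≤u) (no j₀>v)  =
    trans (sum-δ-inside (suc u) i₀ _ i₀≤u)
          (trans (sum-δ-outside (suc v) j₀ (g i₀) (ℕP.≮⇒≥ j₀>v)) (sym (outside i₀ j₀ (inj₂ (ℕP.≮⇒≥ j₀>v)))))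

-- Binomial coefficients with negative upper argument.
-- negBinom m k = binom(−m, k) for k ≥ 0, characterised by Pascal's rule
-- binom(−m, k+1) = binom(−(m+1), k+1) + binom(−(m+1), k) together with
-- binom(0, k) = [k = 0] and binom(−m, 0) = 1.
negBinom : ℕ → ℕ → ℤ
negBinom zero    zero    = + 1
negBinom zero    (suc k) = + 0
negBinom (suc m) zero    = + 1
negBinom (suc m) (suc k) = negBinom m (suc k) - negBinom (suc m) k

negBinomℤ : ℕ → ℤ → ℤ
negBinomℤ m (+ k)    = negBinom m k
negBinomℤ m -[1+ _ ] = + 0

negBinom-zero : ∀ m → negBinom m 0 ≡ + 1
negBinom-zero zero    = refl
negBinom-zero (suc m) = refl

negBinom-pascal : ∀ m k → negBinom m (suc k) ≡ negBinom (suc m) (suc k) + negBinom (suc m) k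
negBinom-pascal m k = sym-sub (negBinom m (suc k)) (negBinom (suc m) k)
  where
  sym-sub : ∀ x y → x ≡ (x - y) + y
  sym-sub = solve-∀

negBinomℤ-pascal : ∀ m z → negBinomℤ m z ≡ negBinomℤ (suc m) z + negBinomℤ (suc m) (z - + 1)
negBinomℤ-pascal m -[1+ n ]  = refl
negBinomℤ-pascal m (+ zero)  = negBinom-zero m
negBinomℤ-pascal m (+ suc k) = negBinom-pascal m k

falling-suc : ∀ a k → falling a (suc k) ≡ a * falling (a - + 1) k
falling-suc a zero    = one a
  where
  one : ∀ a → + 1 * (a - + 0) ≡ a * + 1
  one = solve-∀
falling-suc a (suc k) = trans (cong (_* (a - + suc k)) (falling-suc a k)) (reassoc a (falling (a - + 1) k) (+ k))
  where
  reassoc : ∀ a F k → a * F * (a - (+ 1 + k)) ≡ a * (F * (a - + 1 - k))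
  reassoc = solve-∀

falling-pascal : ∀ a k → falling (a + + 1) (suc k) ≡ falling a (suc k) + + suc k * falling a k
falling-pascal a k = begin
    falling (a + + 1) (suc k)
  ≡⟨ falling-suc (a + + 1) k ⟩
    (a + + 1) * falling (a + + 1 - + 1) k
  ≡⟨ cong (λ z → (a + + 1) * falling z k) (cancel a) ⟩
    (a + + 1) * falling a k
  ≡⟨ expand a (falling a k) (+ k) ⟩
    falling a k * (a - + k) + + suc k * falling a k
  ∎
  where
  open ≡-Reasoning
  cancel : ∀ a → a + + 1 - + 1 ≡ a
  cancel = solve-∀
  expand : ∀ a F k → (a + + 1) * F ≡ F * (a - k) + (+ 1 + k) * F
  expand = solve-∀

falling-neg : ∀ m k → falling (- + m) k ≡ negBinom m k * + (k !)
falling-neg zero    zero    = refl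
falling-neg zero    (suc k) = falling-suc (+ 0) k
falling-neg (suc m) zero    = refl
falling-neg (suc m) (suc k) = begin
    falling a (suc k)
  ≡⟨ sym (add-sub (falling a (suc k)) (+ suc k * falling a k)) ⟩
    (falling a (suc k) + + suc k * falling a k) - + suc k * falling a k
  ≡⟨ cong₂ (λ x y → x - + suc k * y) (sym (falling-pascal a k)) (falling-neg (suc m) k) ⟩
    falling (a + + 1) (suc k) - + suc k * (negBinom (suc m) k * + (k !))
  ≡⟨ cong (λ x → x - + suc k * (negBinom (suc m) k * + (k !))) (trans (cong (λ z → falling z (suc k)) (neg-suc m)) (falling-neg m (suc k))) ⟩
    negBinom m (suc k) * + (suc k !) - + suc k * (negBinom (suc m) k * + (k !))
  ≡⟨ cong (λ x → negBinom m (suc k) * x - + suc k * (negBinom (suc m) k * + (k !))) (ℤP.pos-* (suc k) (k !)) ⟩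
    negBinom m (suc k) * (+ suc k * + (k !)) - + suc k * (negBinom (suc m) k * + (k !))
  ≡⟨ factor (negBinom m (suc k)) (negBinom (suc m) k) (+ suc k) (+ (k !)) ⟩
    negBinom (suc m) (suc k) * (+ suc k * + (k !))
  ≡⟨ cong (negBinom (suc m) (suc k) *_) (sym (ℤP.pos-* (suc k) (k !))) ⟩
    negBinom (suc m) (suc k) * + (suc k !)
  ∎
  where
  open ≡-Reasoning
  a : ℤ
  a = - + suc m
  add-sub : ∀ x y → (x + y) - y ≡ x
  add-sub = solve-∀
  factor : ∀ p q s f → p * (s * f) - s * (q * f) ≡ (p - q) * (s * f)
  factor = solve-∀
  neg-suc : ∀ m → - + suc m + + 1 ≡ - + m
  neg-suc zero    = refl
  neg-suc (suc m) = refl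

*-/ℕ-cancel : ∀ x d .{{_ : ℕ.NonZero d}} → (x * + d) /ℕ d ≡ x
*-/ℕ-cancel (+ n) d = trans (cong (_/ℕ d) (sym (ℤP.pos-* n d))) (cong +_ (ℕD.m*n/n≡m n d))
*-/ℕ-cancel -[1+ n ] (suc e) with suc (e ℕ.+ n ℕ.* suc e) ℕ.% suc e in rem
... | zero  = cong (λ z → - (+ z)) (ℕD.m*n/n≡m (suc n) (suc e))
... | suc r with () <- trans (sym rem) (ℕD.m*n%n≡0 (suc n) (suc e))

binom-neg : ∀ m k → binom (- + m) (+ k) ≡ negBinom m k
binom-neg m k = trans (cong (λ z → (z /ℕ (k !)) {{k !≢0}}) (falling-neg m k))
                      (*-/ℕ-cancel (negBinom m k) (k !) {{k !≢0}})

binom-negℤ : ∀ m z → binom (- + m) z ≡ negBinomℤ m z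
binom-negℤ m (+ k)    = binom-neg m k
binom-negℤ m -[1+ _ ] = refl

isEven : ℕ → Bool
isEven zero          = true
isEven (suc zero)    = false
isEven (suc (suc n)) = isEven n

-- Ecoef m X Y is the coefficient of s^X t^Y in ((1 + t)(1 + s²t))^(−m), namely
-- binom(−m, X/2)·binom(−m, Y − X/2) for even X ≥ 0 and 0 otherwise.
Ecoef : ℕ → ℤ → ℤ → ℤ
Ecoef m (+ d)    Y = if isEven d then negBinom m ⌊ d /2⌋ * negBinomℤ m (Y - + ⌊ d /2⌋) else + 0
Ecoef m -[1+ _ ] Y = + 0

-- E_m = E_{m+1}·(1 + t)(1 + s²t), read off coefficientwise: this is what drives the
-- telescoping in the main argument.
E-pascal : ∀ m X Y → Ecoef m X Y ≡ Ecoef (suc m) X Y + Ecoef (suc m) X (Y - + 1)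
                              + Ecoef (suc m) (X - + 2) (Y - + 1) + Ecoef (suc m) (X - + 2) (Y - + 2)
E-pascal m -[1+ n ]     Y = refl
E-pascal m (+ zero)     Y rewrite ℤP.+-identityʳ Y | ℤP.+-identityʳ (Y - + 1) | negBinom-zero m =
  trans (ℤP.*-identityˡ (negBinomℤ m Y)) (trans (negBinomℤ-pascal m Y) (pad (negBinomℤ (suc m) Y) (negBinomℤ (suc m) (Y - + 1))))
  where
  pad : ∀ a b → a + b ≡ + 1 * a + + 1 * b + + 0 + + 0
  pad = solve-∀
E-pascal m (+ suc zero) Y = refl
E-pascal m (+ suc (suc d)) Y with isEven d
... | false = refl
... | true  = begin
    negBinom m (suc h) * negBinomℤ m Z
  ≡⟨ cong₂ _*_ (negBinom-pascal m h) (negBinomℤ-pascal m Z) ⟩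
    (b (suc h) + b h) * (bz Z + bz (Z - + 1))
  ≡⟨ expand (b (suc h)) (b h) (bz Z) (bz (Z - + 1)) ⟩
    b (suc h) * bz Z + b (suc h) * bz (Z - + 1) + b h * bz Z + b h * bz (Z - + 1)
  ≡⟨ cong₂ _+_ (cong₂ _+_ (cong (λ w → b (suc h) * bz Z + b (suc h) * bz w) (r₁ Y (+ h)))
                          (cong (λ w → b h * bz w) (r₂ Y (+ h))))
               (cong (λ w → b h * bz w) (r₃ Y (+ h))) ⟩
    b (suc h) * bz (Y - + suc h) + b (suc h) * bz (Y - + 1 - + suc h)
      + b h * bz (Y - + 1 - + h) + b h * bz (Y - + 2 - + h)
  ∎
  where
  open ≡-Reasoning
  h : ℕ
  h = ⌊ d /2⌋
  Z : ℤ
  Z = Y - + suc h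
  b : ℕ → ℤ
  b = negBinom (suc m)
  bz : ℤ → ℤ
  bz = negBinomℤ (suc m)
  expand : ∀ a b c d → (a + b) * (c + d) ≡ a * c + a * d + b * c + b * d
  expand = solve-∀
  r₁ : ∀ Y h → Y - (+ 1 + h) - + 1 ≡ Y - + 1 - (+ 1 + h)
  r₁ = solve-∀
  r₂ : ∀ Y h → Y - (+ 1 + h) ≡ Y - + 1 - h
  r₂ = solve-∀
  r₃ : ∀ Y h → Y - (+ 1 + h) - + 1 ≡ Y - + 2 - h
  r₃ = solve-∀

E-negʸ : ∀ m X k → Ecoef m X -[1+ k ] ≡ + 0
E-negʸ m -[1+ _ ] k = refl
E-negʸ m (+ d)    k with isEven d
... | false = refl
... | true  = trans (cong (λ z → negBinom m ⌊ d /2⌋ * negBinomℤ m z) (neg-minus k ⌊ d /2⌋))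
                    (ℤP.*-zeroʳ (negBinom m ⌊ d /2⌋))

E-origin : ∀ m → Ecoef m (+ 0) (+ 0) ≡ + 1
E-origin m rewrite negBinom-zero m = refl

E₀-shifted : ∀ u v → Ecoef 0 (+ u - + 1) (+ v - + 1) ≡ bvec (u , v)
E₀-shifted zero v = refl
E₀-shifted (suc zero) zero = refl
E₀-shifted (suc zero) (suc zero) = refl
E₀-shifted (suc zero) (suc (suc v)) = refl
E₀-shifted (suc (suc u)) v = odd-or-positive u (+ v - + 1)
  where
  odd-or-positive : ∀ d Y → Ecoef 0 (+ suc d) Y ≡ + 0
  odd-or-positive zero    Y = refl
  odd-or-positive (suc d) Y with isEven d
  ... | false = refl
  ... | true  = refl

%2≡isEven : ∀ d → d ℕ.% 2 ≡ (if isEven d then 0 else 1)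
%2≡isEven zero          = refl
%2≡isEven (suc zero)    = refl
%2≡isEven (suc (suc d)) =
  trans (trans (cong (ℕ._% 2) (ℕP.+-comm 2 d)) (ℕD.[m+n]%n≡m%n d 2)) (%2≡isEven d)

/2≡⌊/2⌋ : ∀ d → d ℕ./ 2 ≡ ⌊ d /2⌋
/2≡⌊/2⌋ zero          = refl
/2≡⌊/2⌋ (suc zero)    = refl
/2≡⌊/2⌋ (suc (suc d)) =
  trans (ℕD.m/n≡1+[m∸n]/n {suc (suc d)} {2} (ℕ.s≤s (ℕ.s≤s ℕ.z≤n))) (cong suc (/2≡⌊/2⌋ d))

mod₂-+ : ∀ i d → (i ℕ.+ d) ℕ.% 2 ≡ (i ℕ.% 2 ℕ.+ d ℕ.% 2) ℕ.% 2
mod₂-+ i d = ℕD.%-distribˡ-+ i d 2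

same-parity : ∀ i d → ⌊ (i ℕ.% 2) ℕ.≟ ((i ℕ.+ d) ℕ.% 2) ⌋ ≡ isEven d
same-parity i d rewrite mod₂-+ i d | %2≡isEven i | %2≡isEven d with isEven i | isEven d
... | true  | true  = refl
... | true  | false = refl
... | false | true  = refl
... | false | false = refl

c-unfold : ∀ u v i j → c u v i j ≡
  (if ⌊ (i ℕ.% 2) ℕ.≟ (u ℕ.% 2) ⌋
   then binom (- + (i ℕ.⊓ j)) ((+ u - + i) /ℕ 2) * binom (- + (i ℕ.⊓ j)) (+ v - + j - ((+ u - + i) /ℕ 2))
   else + 0)
c-unfold u v i j with ⌊ (i ℕ.% 2) ℕ.≟ (u ℕ.% 2) ⌋
... | false = refl
... | true  = refl

-- Negative integers stay negative under /ℕ 2 (which rounds towards −∞).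
negative-/ℕ2 : ∀ d → Σ ℕ λ k → -[1+ d ] /ℕ 2 ≡ -[1+ k ]
negative-/ℕ2 d with -[1+ d ] /ℕ 2 | [n/ℕd]*d≤n -[1+ d ] 2
... | -[1+ k ] | _  = k , refl
... | + zero   | ()
... | + suc k  | ()

c-above : ∀ i d v j → c (i ℕ.+ d) v i j ≡ Ecoef (i ℕ.⊓ j) (+ (i ℕ.+ d) - + i) (+ v - + j)
c-above i d v j
  rewrite c-unfold (i ℕ.+ d) v i j | same-parity i d | +-∸-+ i d | /2≡⌊/2⌋ d
        | binom-neg (i ℕ.⊓ j) ⌊ d /2⌋ | binom-negℤ (i ℕ.⊓ j) (+ v - + j - + ⌊ d /2⌋)
  with isEven d
... | true  = refl
... | false = refl

c-below : ∀ u d v j → c u v (u ℕ.+ suc d) j ≡ Ecoef ((u ℕ.+ suc d) ℕ.⊓ j) (+ u - + (u ℕ.+ suc d)) (+ v - + j)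
c-below u d v j rewrite c-unfold u v (u ℕ.+ suc d) j | +-∸-+suc u d with negative-/ℕ2 d
... | k , eq rewrite eq with ⌊ ((u ℕ.+ suc d) ℕ.% 2) ℕ.≟ (u ℕ.% 2) ⌋
...   | true  = refl
...   | false = refl

c≡E : ∀ u v i j → c u v i j ≡ Ecoef (i ℕ.⊓ j) (+ u - + i) (+ v - + j)
c≡E u v i j with i ℕ.≤? u
... | yes i≤u with ℕP.m≤n⇒∃[o]m+o≡n i≤u
...   | d , refl = c-above i d v j
c≡E u v i j | no i≰u with ℕP.m≤n⇒∃[o]m+o≡n (ℕP.≰⇒> i≰u)
...   | d , eq = subst (λ i → c u v i j ≡ Ecoef (i ℕ.⊓ j) (+ u - + i) (+ v - + j))
                       (trans (ℕP.+-suc u d) eq) (c-below u d v j)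

E-outside : ∀ m u v i j → u < i ⊎ v < j → Ecoef m (+ u - + i) (+ v - + j) ≡ + 0
E-outside m u v i j (inj₁ u<i) with <⇒negative u<i
... | k , eq rewrite eq = refl
E-outside m u v i j (inj₂ v<j) with <⇒negative v<j
... | k , eq rewrite eq = E-negʸ m (+ u - + i) k

c-diag : ∀ u v → c u v u v ≡ + 1
c-diag u v rewrite c≡E u v u v | ℤP.+-inverseʳ (+ u) | ℤP.+-inverseʳ (+ v) = E-origin (u ℕ.⊓ v)

c-outside : ∀ u v i j → u < i ⊎ v < j → c u v i j ≡ + 0
c-outside u v i j out = trans (c≡E u v i j) (E-outside (i ℕ.⊓ j) u v i j out)

𝟙 : Bool → ℕ
𝟙 b = if b then 1 else 0

countTrue-∷ : ∀ {A : Set} (P : A → Bool) x xs → countTrue P (x ∷ xs) ≡ 𝟙 (P x) ℕ.+ countTrue P xs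
countTrue-∷ P x xs with P x
... | true  = refl
... | false = refl

countTrue-++ : ∀ {A : Set} (P : A → Bool) xs ys → countTrue P (xs ++ ys) ≡ countTrue P xs ℕ.+ countTrue P ys
countTrue-++ P []       ys = refl
countTrue-++ P (x ∷ xs) ys =
  trans (countTrue-∷ P x (xs ++ ys))
        (trans (cong (𝟙 (P x) ℕ.+_) (countTrue-++ P xs ys))
               (trans (sym (ℕP.+-assoc (𝟙 (P x)) _ _)) (cong (ℕ._+ countTrue P ys) (sym (countTrue-∷ P x xs)))))

countTrue-∧ : ∀ {A : Set} b (P Q : A → Bool) xs →
  countTrue (λ w → (b ∧ P w) ∧ Q w) xs ≡ 𝟙 b ℕ.* countTrue (λ w → P w ∧ Q w) xs
countTrue-∧ true  P Q xs = sym (ℕP.+-identityʳ _)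
countTrue-∧ false P Q xs = all-false xs
  where
  all-false : ∀ xs → countTrue (λ _ → false) xs ≡ 0
  all-false []       = refl
  all-false (x ∷ xs) = all-false xs

Σₛ : (Step → ℕ) → ℕ
Σₛ g = g E ℕ.+ g W ℕ.+ g NE ℕ.+ g SW

Σₛ-cong : ∀ {g h : Step → ℕ} → (∀ s → g s ≡ h s) → Σₛ g ≡ Σₛ h
Σₛ-cong eq = cong₂ ℕ._+_ (cong₂ ℕ._+_ (cong₂ ℕ._+_ (eq E) (eq W)) (eq NE)) (eq SW)

Σₛ-*ˡ : ∀ a (g : Step → ℕ) → Σₛ (λ s → a ℕ.* g s) ≡ a ℕ.* Σₛ g
Σₛ-*ˡ a g = distrib a (g E) (g W) (g NE) (g SW)
  where
  distrib : ∀ a x y z w → a ℕ.* x ℕ.+ a ℕ.* y ℕ.+ a ℕ.* z ℕ.+ a ℕ.* w ≡ a ℕ.* (x ℕ.+ y ℕ.+ z ℕ.+ w)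
  distrib = solveℕ

Σₛ-swap : ∀ (g : Step → Step → ℕ) → Σₛ (λ s → Σₛ (g s)) ≡ Σₛ (λ t → Σₛ (λ s → g s t))
Σₛ-swap g = interchange (g E E) (g E W) (g E NE) (g E SW) (g W E) (g W W) (g W NE) (g W SW)
                        (g NE E) (g NE W) (g NE NE) (g NE SW) (g SW E) (g SW W) (g SW NE) (g SW SW)
  where
  interchange : ∀ a₁ a₂ a₃ a₄ b₁ b₂ b₃ b₄ c₁ c₂ c₃ c₄ d₁ d₂ d₃ d₄ →
    (a₁ ℕ.+ a₂ ℕ.+ a₃ ℕ.+ a₄) ℕ.+ (b₁ ℕ.+ b₂ ℕ.+ b₃ ℕ.+ b₄) ℕ.+ (c₁ ℕ.+ c₂ ℕ.+ c₃ ℕ.+ c₄) ℕ.+ (d₁ ℕ.+ d₂ ℕ.+ d₃ ℕ.+ d₄)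
    ≡ (a₁ ℕ.+ b₁ ℕ.+ c₁ ℕ.+ d₁) ℕ.+ (a₂ ℕ.+ b₂ ℕ.+ c₂ ℕ.+ d₂) ℕ.+ (a₃ ℕ.+ b₃ ℕ.+ c₃ ℕ.+ d₃) ℕ.+ (a₄ ℕ.+ b₄ ℕ.+ c₄ ℕ.+ d₄)
  interchange = solveℕ

countTrue-extend : ∀ (P : List Step → Bool) ws →
  countTrue P (concatMap (λ w → map (λ s → s ∷ w) (E ∷ W ∷ NE ∷ SW ∷ [])) ws)
  ≡ Σₛ (λ s → countTrue (λ w → P (s ∷ w)) ws)
countTrue-extend P []       = refl
countTrue-extend P (w ∷ ws) = begin
    countTrue P (four ++ rest)
  ≡⟨ countTrue-++ P four rest ⟩
    countTrue P four ℕ.+ countTrue P rest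
  ≡⟨ cong₂ ℕ._+_ (first-four P) (countTrue-extend P ws) ⟩
    (𝟙 (P (E ∷ w)) ℕ.+ (𝟙 (P (W ∷ w)) ℕ.+ (𝟙 (P (NE ∷ w)) ℕ.+ (𝟙 (P (SW ∷ w)) ℕ.+ 0))))
      ℕ.+ Σₛ (λ s → countTrue (λ w → P (s ∷ w)) ws)
  ≡⟨ regroup (𝟙 (P (E ∷ w))) (𝟙 (P (W ∷ w))) (𝟙 (P (NE ∷ w))) (𝟙 (P (SW ∷ w)))
             (tails E) (tails W) (tails NE) (tails SW) ⟩
    Σₛ (λ s → 𝟙 (P (s ∷ w)) ℕ.+ countTrue (λ w → P (s ∷ w)) ws)
  ≡⟨ Σₛ-cong (λ s → sym (countTrue-∷ (λ w → P (s ∷ w)) w ws)) ⟩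
    Σₛ (λ s → countTrue (λ w → P (s ∷ w)) (w ∷ ws))
  ∎
  where
  open ≡-Reasoning
  tails : Step → ℕ
  tails s = countTrue (λ w → P (s ∷ w)) ws
  four : List (List Step)
  four = (E ∷ w) ∷ (W ∷ w) ∷ (NE ∷ w) ∷ (SW ∷ w) ∷ []
  rest : List (List Step)
  rest = concatMap (λ w → map (λ s → s ∷ w) (E ∷ W ∷ NE ∷ SW ∷ [])) ws
  first-four : ∀ (P : List Step → Bool) → countTrue P four
    ≡ 𝟙 (P (E ∷ w)) ℕ.+ (𝟙 (P (W ∷ w)) ℕ.+ (𝟙 (P (NE ∷ w)) ℕ.+ (𝟙 (P (SW ∷ w)) ℕ.+ 0)))
  first-four P =
    trans (countTrue-∷ P (E ∷ w) ((W ∷ w) ∷ (NE ∷ w) ∷ (SW ∷ w) ∷ [])) (cong (𝟙 (P (E ∷ w)) ℕ.+_)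
    (trans (countTrue-∷ P (W ∷ w) ((NE ∷ w) ∷ (SW ∷ w) ∷ [])) (cong (𝟙 (P (W ∷ w)) ℕ.+_)
    (trans (countTrue-∷ P (NE ∷ w) ((SW ∷ w) ∷ [])) (cong (𝟙 (P (NE ∷ w)) ℕ.+_) (countTrue-∷ P (SW ∷ w) []))))))
  regroup : ∀ a b c d A B C D → (a ℕ.+ (b ℕ.+ (c ℕ.+ (d ℕ.+ 0)))) ℕ.+ (A ℕ.+ B ℕ.+ C ℕ.+ D)
    ≡ a ℕ.+ A ℕ.+ (b ℕ.+ B) ℕ.+ (c ℕ.+ C) ℕ.+ (d ℕ.+ D)
  regroup = solveℕ

walks : ℕ → ℤ × ℤ → ℤ × ℤ → ℕ
walks m p q = countTrue (λ w → staysFrom p w ∧ samePoint (endFrom p w) q) (allWalks m)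

walks-first : ∀ m p q → walks (suc m) p q ≡ 𝟙 (inQuadrant p) ℕ.* Σₛ (λ s → walks m (move p s) q)
walks-first m p q = begin
    walks (suc m) p q
  ≡⟨ countTrue-extend (λ w → staysFrom p w ∧ samePoint (endFrom p w) q) (allWalks m) ⟩
    Σₛ (λ s → countTrue (λ w → (inQuadrant p ∧ staysFrom (move p s) w) ∧ samePoint (endFrom (move p s) w) q) (allWalks m))
  ≡⟨ Σₛ-cong (λ s → countTrue-∧ (inQuadrant p) (staysFrom (move p s)) (λ w → samePoint (endFrom (move p s) w) q) (allWalks m)) ⟩
    Σₛ (λ s → 𝟙 (inQuadrant p) ℕ.* walks m (move p s) q)
  ≡⟨ Σₛ-*ˡ (𝟙 (inQuadrant p)) (λ s → walks m (move p s) q) ⟩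
    𝟙 (inQuadrant p) ℕ.* Σₛ (λ s → walks m (move p s) q)
  ∎
  where open ≡-Reasoning

opp : Step → Step
opp E  = W
opp W  = E
opp NE = SW
opp SW = NE

+1-1 : ∀ x → x + + 1 - + 1 ≡ x
+1-1 = solve-∀

-1+1 : ∀ x → x - + 1 + + 1 ≡ x
-1+1 = solve-∀

+0+0 : ∀ x → x + + 0 + + 0 ≡ x
+0+0 = solve-∀

move-opp : ∀ p s → move (move p s) (opp s) ≡ p
move-opp (x , y) E  = cong₂ _,_ (+1-1 x) (+0+0 y)
move-opp (x , y) W  = cong₂ _,_ (-1+1 x) (+0+0 y)
move-opp (x , y) NE = cong₂ _,_ (+1-1 x) (+1-1 y)
move-opp (x , y) SW = cong₂ _,_ (-1+1 x) (-1+1 y)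

opp-opp : ∀ s → opp (opp s) ≡ s
opp-opp E  = refl
opp-opp W  = refl
opp-opp NE = refl
opp-opp SW = refl

move-opp′ : ∀ q s → move (move q (opp s)) s ≡ q
move-opp′ q s = trans (cong (move (move q (opp s))) (sym (opp-opp s))) (move-opp q (opp s))

≟-translate : ∀ a c d → ⌊ a + d ℤ.≟ c + d ⌋ ≡ ⌊ a ℤ.≟ c ⌋
≟-translate a c d with a ℤ.≟ c | a + d ℤ.≟ c + d
... | yes _   | yes _  = refl
... | no _    | no _   = refl
... | yes a≡c | no a+d≢c+d = ⊥-elim (a+d≢c+d (cong (_+ d) a≡c))
... | no a≢c  | yes a+d≡c+d = ⊥-elim (a≢c (∙-cancelʳ d a c a+d≡c+d))

samePoint-translate : ∀ p q s → samePoint (move p s) (move q s) ≡ samePoint p q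
samePoint-translate (a , b) (c , d) s with stepVec s
... | (dx , dy) = cong₂ _∧_ (≟-translate a c dx) (≟-translate b d dy)

samePoint-move : ∀ p q s → samePoint (move p s) q ≡ samePoint p (move q (opp s))
samePoint-move p q s = begin
    samePoint (move p s) q
  ≡⟨ cong (samePoint (move p s)) (sym (move-opp′ q s)) ⟩
    samePoint (move p s) (move (move q (opp s)) s)
  ≡⟨ samePoint-translate p (move q (opp s)) s ⟩
    samePoint p (move q (opp s))
  ∎
  where open ≡-Reasoning

samePoint-≡ : ∀ a b → samePoint a b ≡ true → a ≡ b
samePoint-≡ (a₁ , a₂) (b₁ , b₂) eq with a₁ ℤ.≟ b₁ | a₂ ℤ.≟ b₂
samePoint-≡ (a₁ , a₂) (b₁ , b₂) refl | yes refl | yes refl = refl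
samePoint-≡ (a₁ , a₂) (b₁ , b₂) ()   | yes _    | no _
samePoint-≡ (a₁ , a₂) (b₁ , b₂) ()   | no _     | _

step-arrives : ∀ p q s → samePoint p (move q (opp s)) ≡ true → move p s ≡ q
step-arrives p q s p≡q-s = trans (cong (λ z → move z s) (samePoint-≡ p (move q (opp s)) p≡q-s)) (move-opp′ q s)

step-reversal : ∀ p q s → 𝟙 (inQuadrant p) ℕ.* walks 0 (move p s) q ≡ 𝟙 (inQuadrant q) ℕ.* walks 0 p (move q (opp s))
step-reversal p q s = begin
    𝟙 (inQuadrant p) ℕ.* 𝟙 (inQuadrant (move p s) ∧ samePoint (move p s) q)
  ≡⟨ cong (λ σ → 𝟙 (inQuadrant p) ℕ.* 𝟙 (inQuadrant (move p s) ∧ σ)) (samePoint-move p q s) ⟩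
    𝟙 (inQuadrant p) ℕ.* 𝟙 (inQuadrant (move p s) ∧ samePoint p (move q (opp s)))
  ≡⟨ reverse (samePoint p (move q (opp s))) refl ⟩
    𝟙 (inQuadrant q) ℕ.* 𝟙 (inQuadrant p ∧ samePoint p (move q (opp s)))
  ∎
  where
  open ≡-Reasoning
  reverse : ∀ σ → samePoint p (move q (opp s)) ≡ σ →
    𝟙 (inQuadrant p) ℕ.* 𝟙 (inQuadrant (move p s) ∧ σ) ≡ 𝟙 (inQuadrant q) ℕ.* 𝟙 (inQuadrant p ∧ σ)
  reverse false _ = begin
      𝟙 (inQuadrant p) ℕ.* 𝟙 (inQuadrant (move p s) ∧ false)
    ≡⟨ cong (λ b → 𝟙 (inQuadrant p) ℕ.* 𝟙 b) (BoolP.∧-zeroʳ (inQuadrant (move p s))) ⟩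
      𝟙 (inQuadrant p) ℕ.* 0
    ≡⟨ trans (ℕP.*-zeroʳ (𝟙 (inQuadrant p))) (sym (ℕP.*-zeroʳ (𝟙 (inQuadrant q)))) ⟩
      𝟙 (inQuadrant q) ℕ.* 0
    ≡⟨ cong (λ b → 𝟙 (inQuadrant q) ℕ.* 𝟙 b) (sym (BoolP.∧-zeroʳ (inQuadrant p))) ⟩
      𝟙 (inQuadrant q) ℕ.* 𝟙 (inQuadrant p ∧ false)
    ∎
  reverse true p≡q-s = begin
      𝟙 (inQuadrant p) ℕ.* 𝟙 (inQuadrant (move p s) ∧ true)
    ≡⟨ cong (λ b → 𝟙 (inQuadrant p) ℕ.* 𝟙 b) (BoolP.∧-identityʳ (inQuadrant (move p s))) ⟩
      𝟙 (inQuadrant p) ℕ.* 𝟙 (inQuadrant (move p s))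
    ≡⟨ cong (λ z → 𝟙 (inQuadrant p) ℕ.* 𝟙 (inQuadrant z)) (step-arrives p q s p≡q-s) ⟩
      𝟙 (inQuadrant p) ℕ.* 𝟙 (inQuadrant q)
    ≡⟨ ℕP.*-comm (𝟙 (inQuadrant p)) (𝟙 (inQuadrant q)) ⟩
      𝟙 (inQuadrant q) ℕ.* 𝟙 (inQuadrant p)
    ≡⟨ cong (λ b → 𝟙 (inQuadrant q) ℕ.* 𝟙 b) (sym (BoolP.∧-identityʳ (inQuadrant p))) ⟩
      𝟙 (inQuadrant q) ℕ.* 𝟙 (inQuadrant p ∧ true)
    ∎

Σₛ-exchange : ∀ a b (g : Step → Step → ℕ) →
  a ℕ.* Σₛ (λ s → b ℕ.* Σₛ (g s)) ≡ b ℕ.* Σₛ (λ t → a ℕ.* Σₛ (λ s → g s t))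
Σₛ-exchange a b g = begin
    a ℕ.* Σₛ (λ s → b ℕ.* Σₛ (g s))
  ≡⟨ cong (a ℕ.*_) (Σₛ-*ˡ b (λ s → Σₛ (g s))) ⟩
    a ℕ.* (b ℕ.* Σₛ (λ s → Σₛ (g s)))
  ≡⟨ cong (λ z → a ℕ.* (b ℕ.* z)) (Σₛ-swap g) ⟩
    a ℕ.* (b ℕ.* Σₛ (λ t → Σₛ (λ s → g s t)))
  ≡⟨ left-comm a b _ ⟩
    b ℕ.* (a ℕ.* Σₛ (λ t → Σₛ (λ s → g s t)))
  ≡⟨ cong (b ℕ.*_) (sym (Σₛ-*ˡ a (λ t → Σₛ (λ s → g s t)))) ⟩
    b ℕ.* Σₛ (λ t → a ℕ.* Σₛ (λ s → g s t))
  ∎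
  where
  open ≡-Reasoning
  left-comm : ∀ a b x → a ℕ.* (b ℕ.* x) ≡ b ℕ.* (a ℕ.* x)
  left-comm = solveℕ

-- By induction on m,
-- peeling the first step on both sides and reversing single steps.
walks-last : ∀ m p q → walks (suc m) p q ≡ 𝟙 (inQuadrant q) ℕ.* Σₛ (λ s → walks m p (move q (opp s)))
walks-last zero p q = begin
    walks 1 p q
  ≡⟨ walks-first 0 p q ⟩
    𝟙 (inQuadrant p) ℕ.* Σₛ (λ s → walks 0 (move p s) q)
  ≡⟨ sym (Σₛ-*ˡ (𝟙 (inQuadrant p)) (λ s → walks 0 (move p s) q)) ⟩
    Σₛ (λ s → 𝟙 (inQuadrant p) ℕ.* walks 0 (move p s) q)
  ≡⟨ Σₛ-cong (step-reversal p q) ⟩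
    Σₛ (λ s → 𝟙 (inQuadrant q) ℕ.* walks 0 p (move q (opp s)))
  ≡⟨ Σₛ-*ˡ (𝟙 (inQuadrant q)) (λ s → walks 0 p (move q (opp s))) ⟩
    𝟙 (inQuadrant q) ℕ.* Σₛ (λ s → walks 0 p (move q (opp s)))
  ∎
  where open ≡-Reasoning
walks-last (suc m) p q = begin
    walks (suc (suc m)) p q
  ≡⟨ walks-first (suc m) p q ⟩
    𝟙 (inQuadrant p) ℕ.* Σₛ (λ s → walks (suc m) (move p s) q)
  ≡⟨ cong (𝟙 (inQuadrant p) ℕ.*_) (Σₛ-cong (λ s → walks-last m (move p s) q)) ⟩
    𝟙 (inQuadrant p) ℕ.* Σₛ (λ s → 𝟙 (inQuadrant q) ℕ.* Σₛ (λ t → walks m (move p s) (move q (opp t))))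
  ≡⟨ Σₛ-exchange (𝟙 (inQuadrant p)) (𝟙 (inQuadrant q)) (λ s t → walks m (move p s) (move q (opp t))) ⟩
    𝟙 (inQuadrant q) ℕ.* Σₛ (λ t → 𝟙 (inQuadrant p) ℕ.* Σₛ (λ s → walks m (move p s) (move q (opp t))))
  ≡⟨ cong (𝟙 (inQuadrant q) ℕ.*_) (Σₛ-cong (λ t → sym (walks-first m p (move q (opp t))))) ⟩
    𝟙 (inQuadrant q) ℕ.* Σₛ (λ t → walks (suc m) p (move q (opp t)))
  ∎
  where open ≡-Reasoning

opaque
  Fℤ : ℕ → ℤ → ℤ → ℤ
  Fℤ m x y = + walks m (+ 0 , + 0) (x , y)

  F≡Fℤ : ∀ m x y → + F (+ m) x y ≡ Fℤ m x y
  F≡Fℤ m x y = refl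

predSum : ℕ → ℤ → ℤ → ℤ
predSum m x y = Fℤ m (x - + 1) y + Fℤ m (x + + 1) y + Fℤ m (x - + 1) (y - + 1) + Fℤ m (x + + 1) (y + + 1)

opaque
  unfolding Fℤ

  Fℤ-suc : ∀ m x y → Fℤ (suc m) x y ≡ + 𝟙 (inQuadrant (x , y)) * predSum m x y
  Fℤ-suc m x y = begin
      + walks (suc m) o (x , y)
    ≡⟨ cong +_ (walks-last m o (x , y)) ⟩
      + (𝟙 inQ ℕ.* Σₛ g)
    ≡⟨ ℤP.pos-* (𝟙 inQ) (Σₛ g) ⟩
      + 𝟙 inQ * + Σₛ g
    ≡⟨ cong (+ 𝟙 inQ *_) (trans (ℤP.pos-+ (g E ℕ.+ g W ℕ.+ g NE) (g SW))
                           (cong (_+ + g SW) (trans (ℤP.pos-+ (g E ℕ.+ g W) (g NE))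
                                              (cong (_+ + g NE) (ℤP.pos-+ (g E) (g W)))))) ⟩
      + 𝟙 inQ * (+ g E + + g W + + g NE + + g SW)
    ≡⟨ cong (λ z → + 𝟙 inQ * (+ walks m o (x - + 1 , z) + + walks m o (x + + 1 , z) + + g NE + + g SW))
            (ℤP.+-identityʳ y) ⟩
      + 𝟙 inQ * predSum m x y
    ∎
    where
    open ≡-Reasoning
    o : ℤ × ℤ
    o = + 0 , + 0
    inQ : Bool
    inQ = inQuadrant (x , y)
    g : Step → ℕ
    g s = walks m o (move (x , y) (opp s))

  Fℤ-negˣ : ∀ m k y → Fℤ m -[1+ k ] y ≡ + 0
  Fℤ-negˣ zero    k y = refl
  Fℤ-negˣ (suc m) k y rewrite Fℤ-suc m -[1+ k ] y = refl

  Fℤ-negʸ : ∀ m x k → Fℤ m x -[1+ k ] ≡ + 0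
  Fℤ-negʸ zero    x k rewrite BoolP.∧-zeroʳ ⌊ + 0 ℤ.≟ x ⌋ = refl
  Fℤ-negʸ (suc m) x k rewrite Fℤ-suc m x -[1+ k ] | BoolP.∧-zeroʳ ⌊ + 0 ℤ.≤? x ⌋ = refl

  Fℤ-zero : ∀ x y → Fℤ 0 x y ≡ + 𝟙 (samePoint (+ 0 , + 0) (x , y))
  Fℤ-zero x y = refl

Ftilde : ℕ → ℤ → ℤ → ℤ
Ftilde m (+ zero)  (+ b)     = + Ftilde-y m b
Ftilde m (+ zero)  -[1+ _ ]  = + 0
Ftilde m (+ suc a) (+ zero)  = + Ftilde-x m (suc a)
Ftilde m (+ suc a) (+ suc b) = + 0
Ftilde m (+ suc a) -[1+ _ ]  = + 0
Ftilde m -[1+ _ ]  _         = + 0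

-- F̃(0; ·) = F(−1; ·) = 0.
Ftilde-zero : ∀ a b → Ftilde 0 a b ≡ + 0
Ftilde-zero (+ zero)  (+ b)     = refl
Ftilde-zero (+ zero)  -[1+ _ ]  = refl
Ftilde-zero (+ suc a) (+ zero)  = refl
Ftilde-zero (+ suc a) (+ suc b) = refl
Ftilde-zero (+ suc a) -[1+ _ ]  = refl
Ftilde-zero -[1+ _ ]  _         = refl

predSum-left : ∀ m y → predSum m -[1+ 0 ] y ≡ Fℤ m (+ 0) y + Fℤ m (+ 0) (y + + 1)
predSum-left m y rewrite Fℤ-negˣ m 1 y | Fℤ-negˣ m 1 (y - + 1) = drop-zeros (Fℤ m (+ 0) y) (Fℤ m (+ 0) (y + + 1))
  where
  drop-zeros : ∀ a b → + 0 + a + + 0 + b ≡ a + b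
  drop-zeros = solve-∀

predSum-far-left : ∀ m a y → predSum m -[1+ suc a ] y ≡ + 0
predSum-far-left m a y
  rewrite Fℤ-negˣ m a y | Fℤ-negˣ m a (y + + 1)
        | Fℤ-negˣ m (suc (suc (a ℕ.+ 0))) y | Fℤ-negˣ m (suc (suc (a ℕ.+ 0))) (y - + 1) = refl

predSum-below : ∀ m x → predSum m x -[1+ 0 ] ≡ Fℤ m (x + + 1) (+ 0)
predSum-below m x rewrite Fℤ-negʸ m (x - + 1) 0 | Fℤ-negʸ m (x + + 1) 0 | Fℤ-negʸ m (x - + 1) 1 =
  ℤP.+-identityˡ (Fℤ m (x + + 1) (+ 0))

predSum-far-below : ∀ m x b → predSum m x -[1+ suc b ] ≡ + 0
predSum-far-below m x b
  rewrite Fℤ-negʸ m (x - + 1) (suc b) | Fℤ-negʸ m (x + + 1) (suc b)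
        | Fℤ-negʸ m (x - + 1) (suc (suc (b ℕ.+ 0))) | Fℤ-negʸ m (x + + 1) b = refl

-- The defect of the walk recurrence at (a−1, b−1) is exactly the boundary value
-- F̃(m+1; a, b): it vanishes strictly inside the quadrant, and on the axes the
-- recurrence, which sees only predecessors, produces F̃ instead of F (which is 0 there).
Ftilde-defect : ∀ m a b → Ftilde (suc m) a b ≡ predSum m (a - + 1) (b - + 1) - Fℤ (suc m) (a - + 1) (b - + 1)
Ftilde-defect m (+ suc a) (+ suc b)
  rewrite Fℤ-suc m (+ a) (+ b) | ℤP.*-identityˡ (predSum m (+ a) (+ b)) = sym (ℤP.+-inverseʳ (predSum m (+ a) (+ b)))
Ftilde-defect m (+ zero) (+ b)
  rewrite predSum-left m (+ b - + 1) | Fℤ-negˣ (suc m) 0 (+ b - + 1) | -1+1 (+ b) = begin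
    + (F (+ m) (+ 0) (+ b) ℕ.+ F (+ m) (+ 0) (+ b - + 1))
  ≡⟨ ℤP.pos-+ (F (+ m) (+ 0) (+ b)) (F (+ m) (+ 0) (+ b - + 1)) ⟩
    + F (+ m) (+ 0) (+ b) + + F (+ m) (+ 0) (+ b - + 1)
  ≡⟨ cong₂ _+_ (F≡Fℤ m (+ 0) (+ b)) (F≡Fℤ m (+ 0) (+ b - + 1)) ⟩
    Fℤ m (+ 0) (+ b) + Fℤ m (+ 0) (+ b - + 1)
  ≡⟨ swap (Fℤ m (+ 0) (+ b)) (Fℤ m (+ 0) (+ b - + 1)) ⟩
    Fℤ m (+ 0) (+ b - + 1) + Fℤ m (+ 0) (+ b) - + 0
  ∎
  where
  open ≡-Reasoning
  swap : ∀ a b → a + b ≡ b + a - + 0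
  swap = solve-∀
Ftilde-defect m (+ zero) -[1+ b ]
  rewrite predSum-left m (-[1+ b ] - + 1) | Fℤ-negˣ (suc m) 0 (-[1+ b ] - + 1)
        | Fℤ-negʸ m (+ 0) (suc (b ℕ.+ 0)) | Fℤ-negʸ m (+ 0) (b ℕ.+ 0) = refl
Ftilde-defect m (+ suc a) (+ zero)
  rewrite predSum-below m (+ a) | Fℤ-negʸ (suc m) (+ a) 0 | ℕP.+-comm a 1 =
  trans (F≡Fℤ m (+ suc a) (+ 0)) (sym (ℤP.+-identityʳ _))
Ftilde-defect m (+ suc a) -[1+ b ]
  rewrite predSum-far-below m (+ a) (b ℕ.+ 0) | Fℤ-negʸ (suc m) (+ a) (suc (b ℕ.+ 0)) = refl
Ftilde-defect m -[1+ a ] b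
  rewrite predSum-far-left m (a ℕ.+ 0) (b - + 1) | Fℤ-negˣ (suc m) (suc (a ℕ.+ 0)) (b - + 1) = refl

f-above : ∀ m b → f m (m ℕ.+ b) ≡ Ftilde-y m b
f-above m b with m ℕ.≤? (m ℕ.+ b)
... | yes _  = cong (Ftilde-y m) (ℕP.m+n∸m≡n m b)
... | no m≰ = ⊥-elim (m≰ (ℕP.m≤m+n m b))

f-below : ∀ m a → f (m ℕ.+ suc a) m ≡ Ftilde-x m (suc a)
f-below m a with (m ℕ.+ suc a) ℕ.≤? m
... | yes ≤m = ⊥-elim (ℕP.m+1+n≰m m ≤m)
... | no _   = cong (Ftilde-x m) (ℕP.m+n∸m≡n m (suc a))

Ftilde-diag-≥ : ∀ m a b → Ftilde m (+ a) (+ b) ≡ δ m ((m ℕ.+ a) ℕ.⊓ (m ℕ.+ b)) * + f (m ℕ.+ a) (m ℕ.+ b)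
Ftilde-diag-≥ m zero b
  rewrite ℕP.+-identityʳ m | ℕP.m≤n⇒m⊓n≡m (ℕP.m≤m+n m b) | δ-refl m | f-above m b = sym (ℤP.*-identityˡ _)
Ftilde-diag-≥ m (suc a) zero
  rewrite ℕP.+-identityʳ m | ℕP.m≥n⇒m⊓n≡n (ℕP.m≤m+n m (suc a)) | δ-refl m | f-below m a = sym (ℤP.*-identityˡ _)
Ftilde-diag-≥ m (suc a) (suc b) = sym (cong (_* + f (m ℕ.+ suc a) (m ℕ.+ suc b)) (δ-≢ m≢min))
  where
  m≢min : m ≢ (m ℕ.+ suc a) ℕ.⊓ (m ℕ.+ suc b)
  m≢min e = ℕP.m≢1+m+n m (trans e (trans (sym (ℕP.+-distribˡ-⊓ m (suc a) (suc b))) (ℕP.+-suc m (a ℕ.⊓ b))))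

Ftilde-diag : ∀ m i j → Ftilde m (+ i - + m) (+ j - + m) ≡ δ m (i ℕ.⊓ j) * + f i j
Ftilde-diag m i j with m ℕ.≤? i
Ftilde-diag m i j | no m≰i with ℕP.m≤n⇒∃[o]m+o≡n (ℕP.≰⇒> m≰i)
... | d , eq rewrite sym (trans (ℕP.+-suc i d) eq) | +-∸-+suc i d
        | δ-≢ {i ℕ.+ suc d} {i ℕ.⊓ j} (λ e → ℕP.m+1+n≰m i (ℕP.≤-trans (ℕP.≤-reflexive e) (ℕP.m⊓n≤m i j))) = refl
Ftilde-diag m i j | yes m≤i with m ℕ.≤? j
Ftilde-diag m i j | yes m≤i | yes m≤j with ℕP.m≤n⇒∃[o]m+o≡n m≤i | ℕP.m≤n⇒∃[o]m+o≡n m≤j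
... | a , refl | b , refl rewrite +-∸-+ m a | +-∸-+ m b = Ftilde-diag-≥ m a b
Ftilde-diag m i j | yes m≤i | no m≰j with ℕP.m≤n⇒∃[o]m+o≡n m≤i | ℕP.m≤n⇒∃[o]m+o≡n (ℕP.≰⇒> m≰j)
... | a , refl | d , eq rewrite +-∸-+ m a | sym (trans (ℕP.+-suc j d) eq) | +-∸-+suc j d
        | δ-≢ {j ℕ.+ suc d} {(j ℕ.+ suc d ℕ.+ a) ℕ.⊓ j}
              (λ e → ℕP.m+1+n≰m j (ℕP.≤-trans (ℕP.≤-reflexive e) (ℕP.m⊓n≤n (j ℕ.+ suc d ℕ.+ a) j))) = below-axis a d
  where
  below-axis : ∀ a d → Ftilde (j ℕ.+ suc d) (+ a) -[1+ d ] ≡ + 0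
  below-axis zero    d = refl
  below-axis (suc a) d = refl

conv-shift : ∀ u v p q (G K : ℤ → ℤ → ℤ) →
  (∀ x k → G x -[1+ k ] ≡ + 0) → (∀ y k → G -[1+ k ] y ≡ + 0) →
  (∀ x k → K x -[1+ k ] ≡ + 0) → (∀ y k → K -[1+ k ] y ≡ + 0) →
  boxSum u v (λ i j → G (+ i - + p) (+ j - + q) * K (+ u - + i) (+ v - + j))
  ≡ boxSum u v (λ i j → G (+ i) (+ j) * K (+ u - + i - + p) (+ v - + j - + q))
conv-shift u v p q G K Gʸ Gˣ Kʸ Kˣ =
  trans (boxSum-cong u v (λ i j → cong (G (+ i - + p) (+ j - + q) *_)
                                       (cong₂ K (unshift (+ u) (+ i) (+ p)) (unshift (+ v) (+ j) (+ q)))))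
        (boxSum-shift u v p q h hʸ hˣ topʸ topˣ)
  where
  h : ℤ → ℤ → ℤ
  h x y = G x y * K (+ u - x - + p) (+ v - y - + q)
  unshift : ∀ u i p → u - i ≡ u - (i - p) - p
  unshift = solve-∀
  reflect : ∀ v t q → v - (v - t) - q ≡ t - q
  reflect = solve-∀
  hʸ : ∀ x k → h x -[1+ k ] ≡ + 0
  hʸ x k = cong (_* K (+ u - x - + p) (+ v - -[1+ k ] - + q)) (Gʸ x k)
  hˣ : ∀ y k → h -[1+ k ] y ≡ + 0
  hˣ y k = cong (_* K (+ u - -[1+ k ] - + p) (+ v - y - + q)) (Gˣ y k)
  topʸ : ∀ x t → t < q → h x (+ v - + t) ≡ + 0
  topʸ x t t<q with <⇒negative t<q
  ... | k , t-q≡neg = trans (cong (λ z → G x (+ v - + t) * K (+ u - x - + p) z) (trans (reflect (+ v) (+ t) (+ q)) t-q≡neg))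
                            (trans (cong (G x (+ v - + t) *_) (Kʸ _ k)) (ℤP.*-zeroʳ (G x (+ v - + t))))
  topˣ : ∀ y t → t < p → h (+ u - + t) y ≡ + 0
  topˣ y t t<p with <⇒negative t<p
  ... | k , t-p≡neg = trans (cong (λ z → G (+ u - + t) y * K z (+ v - y - + q)) (trans (reflect (+ u) (+ t) (+ p)) t-p≡neg))
                            (trans (cong (G (+ u - + t) y *_) (Kˣ _ k)) (ℤP.*-zeroʳ (G (+ u - + t) y)))

module Target (u v : ℕ) where

  -- G_m(x, y) = F(m; x − m − 1, y − m − 1): walk counts translated so that walks of
  -- length m start at (m+1, m+1); this makes the boundary value F̃_m sit on the diagonal.
  G : ℕ → ℤ → ℤ → ℤ
  G m x y = Fℤ m (x - + m - + 1) (y - + m - + 1)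

  G-negʸ : ∀ m x k → G m x -[1+ k ] ≡ + 0
  G-negʸ m x k rewrite neg-minus k m | neg-minus (k ℕ.+ m) 1 = Fℤ-negʸ m (x - + m - + 1) (k ℕ.+ m ℕ.+ 1)

  G-negˣ : ∀ m y k → G m -[1+ k ] y ≡ + 0
  G-negˣ m y k rewrite neg-minus k m | neg-minus (k ℕ.+ m) 1 = Fℤ-negˣ m (k ℕ.+ m ℕ.+ 1) (y - + m - + 1)

  Φ : ℕ → ℤ
  Φ m = boxSum u v (λ i j → G m (+ i) (+ j) * Ecoef m (+ u - + i) (+ v - + j))

  predSum-G : ∀ m i j → predSum m (+ i - + suc m - + 1) (+ j - + suc m - + 1)
    ≡ G m (+ i - + 2) (+ j - + 1) + G m (+ i - + 0) (+ j - + 1) + G m (+ i - + 2) (+ j - + 2) + G m (+ i - + 0) (+ j - + 0)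
  predSum-G m i j = cong₂ _+_ (cong₂ _+_ (cong₂ _+_ (cong₂ (Fℤ m) (a₁ (+ i) (+ m)) (a₂ (+ j) (+ m)))
                                                    (cong₂ (Fℤ m) (a₃ (+ i) (+ m)) (a₂ (+ j) (+ m))))
                                         (cong₂ (Fℤ m) (a₁ (+ i) (+ m)) (a₄ (+ j) (+ m))))
                              (cong₂ (Fℤ m) (a₃ (+ i) (+ m)) (a₅ (+ j) (+ m)))
    where
    a₁ : ∀ i m → i - (+ 1 + m) - + 1 - + 1 ≡ i - + 2 - m - + 1
    a₁ = solve-∀
    a₂ : ∀ j m → j - (+ 1 + m) - + 1 ≡ j - + 1 - m - + 1
    a₂ = solve-∀
    a₃ : ∀ i m → i - (+ 1 + m) - + 1 + + 1 ≡ i - + 0 - m - + 1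
    a₃ = solve-∀
    a₄ : ∀ j m → j - (+ 1 + m) - + 1 - + 1 ≡ j - + 2 - m - + 1
    a₄ = solve-∀
    a₅ : ∀ j m → j - (+ 1 + m) - + 1 + + 1 ≡ j - + 0 - m - + 1
    a₅ = solve-∀

  -- Pairing the predecessor sum of G_m with E_{m+1} gives back Φ_m: shift each of the four
  -- terms onto E_{m+1} and recombine them by the Pascal rule for E.
  predSum-pairing : ∀ m → boxSum u v (λ i j → predSum m (+ i - + suc m - + 1) (+ j - + suc m - + 1)
                                            * Ecoef (suc m) (+ u - + i) (+ v - + j)) ≡ Φ m
  predSum-pairing m = begin
      boxSum u v (λ i j → predSum m (+ i - + suc m - + 1) (+ j - + suc m - + 1) * K i j)
    ≡⟨ boxSum-cong u v (λ i j → trans (cong (_* K i j) (predSum-G m i j))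
                                      (distrib (G m (+ i - + 2) (+ j - + 1)) _ _ _ (K i j))) ⟩
      boxSum u v (λ i j → T 2 1 i j + T 0 1 i j + T 2 2 i j + T 0 0 i j)
    ≡⟨ boxSum-+₄ u v (T 2 1) (T 0 1) (T 2 2) (T 0 0) ⟩
      boxSum u v (T 2 1) + boxSum u v (T 0 1) + boxSum u v (T 2 2) + boxSum u v (T 0 0)
    ≡⟨ cong₂ _+_ (cong₂ _+_ (cong₂ _+_ (shift 2 1) (shift 0 1)) (shift 2 2)) (shift 0 0) ⟩
      boxSum u v (T′ 2 1) + boxSum u v (T′ 0 1) + boxSum u v (T′ 2 2) + boxSum u v (T′ 0 0)
    ≡⟨ sym (boxSum-+₄ u v (T′ 2 1) (T′ 0 1) (T′ 2 2) (T′ 0 0)) ⟩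
      boxSum u v (λ i j → T′ 2 1 i j + T′ 0 1 i j + T′ 2 2 i j + T′ 0 0 i j)
    ≡⟨ boxSum-cong u v recombine ⟩
      Φ m
    ∎
    where
    open ≡-Reasoning
    K : ℕ → ℕ → ℤ
    K i j = Ecoef (suc m) (+ u - + i) (+ v - + j)
    T : ℕ → ℕ → ℕ → ℕ → ℤ
    T p q i j = G m (+ i - + p) (+ j - + q) * K i j
    T′ : ℕ → ℕ → ℕ → ℕ → ℤ
    T′ p q i j = G m (+ i) (+ j) * Ecoef (suc m) (+ u - + i - + p) (+ v - + j - + q)
    shift : ∀ p q → boxSum u v (T p q) ≡ boxSum u v (T′ p q)
    shift p q = conv-shift u v p q (G m) (Ecoef (suc m)) (G-negʸ m) (G-negˣ m) (E-negʸ (suc m)) (λ _ _ → refl)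
    distrib : ∀ a b c d k → (a + b + c + d) * k ≡ a * k + b * k + c * k + d * k
    distrib = solve-∀
    factor : ∀ g k₁ k₂ k₃ k₄ → g * k₃ + g * k₂ + g * k₄ + g * k₁ ≡ g * (k₁ + k₂ + k₃ + k₄)
    factor = solve-∀
    recombine : ∀ i j → T′ 2 1 i j + T′ 0 1 i j + T′ 2 2 i j + T′ 0 0 i j ≡ G m (+ i) (+ j) * Ecoef m (+ u - + i) (+ v - + j)
    recombine i j rewrite ℤP.+-identityʳ (+ u - + i) | ℤP.+-identityʳ (+ v - + j) =
      trans (factor (G m (+ i) (+ j)) _ _ _ _) (cong (G m (+ i) (+ j) *_) (sym (E-pascal m (+ u - + i) (+ v - + j))))

  boundarySum : ℕ → ℤ
  boundarySum m = boxSum u v (λ i j → Ftilde m (+ i - + m) (+ j - + m) * Ecoef m (+ u - + i) (+ v - + j))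

  boundarySum-zero : boundarySum 0 ≡ + 0
  boundarySum-zero =
    trans (boxSum-cong u v (λ i j → cong (_* Ecoef 0 (+ u - + i) (+ v - + j)) (Ftilde-zero (+ i - + 0) (+ j - + 0))))
          (boxSum-zero u v)

  -- B_{m+1} = Φ_m − Φ_{m+1}: the boundary value is the defect of the walk recurrence,
  -- whose predecessor part pairs to Φ_m and whose main part is G_{m+1}.
  boundarySum-suc : ∀ m → boundarySum (suc m) ≡ Φ m - Φ (suc m)
  boundarySum-suc m = begin
      boundarySum (suc m)
    ≡⟨ boxSum-cong u v defect ⟩
      boxSum u v (λ i j → P i j - Q i j)
    ≡⟨ boxSum-- u v P Q ⟩
      boxSum u v P - boxSum u v Q
    ≡⟨ cong (_- boxSum u v Q) (predSum-pairing m) ⟩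
      Φ m - Φ (suc m)
    ∎
    where
    open ≡-Reasoning
    K : ℕ → ℕ → ℤ
    K i j = Ecoef (suc m) (+ u - + i) (+ v - + j)
    P : ℕ → ℕ → ℤ
    P i j = predSum m (+ i - + suc m - + 1) (+ j - + suc m - + 1) * K i j
    Q : ℕ → ℕ → ℤ
    Q i j = G (suc m) (+ i) (+ j) * K i j
    sub-distrib : ∀ a b k → (a - b) * k ≡ a * k - b * k
    sub-distrib = solve-∀
    defect : ∀ i j → Ftilde (suc m) (+ i - + suc m) (+ j - + suc m) * K i j ≡ P i j - Q i j
    defect i j = trans (cong (_* K i j) (Ftilde-defect m (+ i - + suc m) (+ j - + suc m)))
                       (sub-distrib (predSum m (+ i - + suc m - + 1) (+ j - + suc m - + 1)) (G (suc m) (+ i) (+ j)) (K i j))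

  telescope : ∀ n → sumTo (suc n) boundarySum ≡ Φ 0 - Φ n
  telescope zero    = trans (cong (λ z → + 0 + z) boundarySum-zero) (sym (ℤP.+-inverseʳ (Φ 0)))
  telescope (suc n) = trans (cong₂ _+_ (telescope n) (boundarySum-suc n)) (cancel (Φ 0) (Φ n) (Φ (suc n)))
    where
    cancel : ∀ a b c → a - b + (b - c) ≡ a - c
    cancel = solve-∀

  -- The telescope starts at b(u, v): G_0 is the indicator of (1, 1) and E_0 that of the origin.
  G-zero : ∀ i j → G 0 (+ i) (+ j) ≡ δ i 1 * δ j 1
  G-zero zero          j             = trans (Fℤ-negˣ 0 0 (+ j - + 0 - + 1)) (sym (cong (_* δ j 1) (δ-≢ (λ ()))))
  G-zero (suc (suc i)) j             = trans (Fℤ-zero (+ suc (suc i) - + 0 - + 1) (+ j - + 0 - + 1)) (sym (cong (_* δ j 1) (δ-≢ (λ ()))))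
  G-zero (suc zero)    zero          = trans (Fℤ-negʸ 0 (+ 0) 0) (sym (trans (cong (δ 1 1 *_) (δ-≢ (λ ()))) (ℤP.*-zeroʳ (δ 1 1))))
  G-zero (suc zero)    (suc zero)    = trans (Fℤ-zero (+ 0) (+ 0)) (sym (cong₂ _*_ (δ-refl 1) (δ-refl 1)))
  G-zero (suc zero)    (suc (suc j)) = trans (Fℤ-zero (+ 1 - + 0 - + 1) (+ suc (suc j) - + 0 - + 1)) (sym (trans (cong (δ 1 1 *_) (δ-≢ (λ ()))) (ℤP.*-zeroʳ (δ 1 1))))

  Φ-zero : Φ 0 ≡ bvec (u , v)
  Φ-zero = begin
      boxSum u v (λ i j → G 0 (+ i) (+ j) * Ecoef 0 (+ u - + i) (+ v - + j))
    ≡⟨ boxSum-cong u v (λ i j → cong (_* Ecoef 0 (+ u - + i) (+ v - + j)) (G-zero i j)) ⟩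
      boxSum u v (λ i j → (δ i 1 * δ j 1) * Ecoef 0 (+ u - + i) (+ v - + j))
    ≡⟨ boxSum-δ u v (λ i j → Ecoef 0 (+ u - + i) (+ v - + j)) (E-outside 0 u v) 1 1 ⟩
      Ecoef 0 (+ u - + 1) (+ v - + 1)
    ≡⟨ E₀-shifted u v ⟩
      bvec (u , v)
    ∎
    where open ≡-Reasoning

  -- … and ends at 0: walks of length u start at (u+1, u+1), outside the box.
  Φ-top : Φ u ≡ + 0
  Φ-top = trans (boxSum-cong< u v (λ i j i≤u _ → vanish i i≤u j)) (boxSum-zero u v)
    where
    regroup : ∀ i u → i - u - + 1 ≡ i - (u + + 1)
    regroup = solve-∀
    vanish : ∀ i → i < suc u → ∀ j → G u (+ i) (+ j) * Ecoef u (+ u - + i) (+ v - + j) ≡ + 0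
    vanish i i≤u j with <⇒negative {i} {u ℕ.+ 1} (subst (i <_) (ℕP.+-comm 1 u) i≤u)
    ... | k , eq rewrite regroup (+ i) (+ u) | sym (ℤP.pos-+ u 1) | eq | Fℤ-negˣ u k (+ j - + u - + 1) = refl

  cf-expand : ∀ i j → i < suc u → c u v i j * + f i j
    ≡ sumTo (suc u) (λ m → Ftilde m (+ i - + m) (+ j - + m) * Ecoef m (+ u - + i) (+ v - + j))
  cf-expand i j i≤u = sym (begin
      sumTo (suc u) (λ m → Ftilde m (+ i - + m) (+ j - + m) * Ecoef m (+ u - + i) (+ v - + j))
    ≡⟨ sum-cong (suc u) (λ m → trans (cong (_* Ecoef m (+ u - + i) (+ v - + j)) (Ftilde-diag m i j))
                                     (ℤP.*-assoc (δ m (i ℕ.⊓ j)) (+ f i j) _)) ⟩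
      sumTo (suc u) (λ m → δ m (i ℕ.⊓ j) * (+ f i j * Ecoef m (+ u - + i) (+ v - + j)))
    ≡⟨ sum-δ-inside (suc u) (i ℕ.⊓ j) (λ m → + f i j * Ecoef m (+ u - + i) (+ v - + j)) (ℕP.≤-<-trans (ℕP.m⊓n≤m i j) i≤u) ⟩
      + f i j * Ecoef (i ℕ.⊓ j) (+ u - + i) (+ v - + j)
    ≡⟨ ℤP.*-comm (+ f i j) _ ⟩
      Ecoef (i ℕ.⊓ j) (+ u - + i) (+ v - + j) * + f i j
    ≡⟨ cong (_* + f i j) (sym (c≡E u v i j)) ⟩
      c u v i j * + f i j
    ∎)
    where open ≡-Reasoning

  box-identity : boxSum u v (λ i j → c u v i j * + f i j) ≡ bvec (u , v)
  box-identity = begin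
      boxSum u v (λ i j → c u v i j * + f i j)
    ≡⟨ boxSum-cong< u v (λ i j i≤u _ → cf-expand i j i≤u) ⟩
      boxSum u v (λ i j → sumTo (suc u) (λ m → H m i j))
    ≡⟨ boxSum-def u v _ ⟩
      sumTo (suc u) (λ i → sumTo (suc v) (λ j → sumTo (suc u) (λ m → H m i j)))
    ≡⟨ sum-cong (suc u) (λ i → sum-swap (suc v) (suc u) (λ j m → H m i j)) ⟩
      sumTo (suc u) (λ i → sumTo (suc u) (λ m → sumTo (suc v) (λ j → H m i j)))
    ≡⟨ sum-swap (suc u) (suc u) (λ i m → sumTo (suc v) (λ j → H m i j)) ⟩
      sumTo (suc u) (λ m → sumTo (suc u) (λ i → sumTo (suc v) (λ j → H m i j)))
    ≡⟨ sum-cong (suc u) (λ m → sym (boxSum-def u v (H m))) ⟩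
      sumTo (suc u) boundarySum
    ≡⟨ telescope u ⟩
      Φ 0 - Φ u
    ≡⟨ cong₂ _-_ Φ-zero Φ-top ⟩
      bvec (u , v) - + 0
    ≡⟨ ℤP.+-identityʳ _ ⟩
      bvec (u , v)
    ∎
    where
    open ≡-Reasoning
    H : ℕ → ℕ → ℕ → ℤ
    H m i j = Ftilde m (+ i - + m) (+ j - + m) * Ecoef m (+ u - + i) (+ v - + j)

Monotone : (ℕ × ℕ) ↔ ℕ → Set
Monotone ρ = ∀ a b c′ d → a ≤ c′ → b ≤ d → Inverse.to ρ (a , b) ≤ Inverse.to ρ (c′ , d)

module Enumeration (ρ : (ℕ × ℕ) ↔ ℕ) where
  open Inverse ρ

  δ-split : ∀ k i j → δ k (to (i , j)) ≡ δ i (proj₁ (from k)) * δ j (proj₂ (from k))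
  δ-split k i j with k ℕ.≟ to (i , j)
  ... | yes refl rewrite strictlyInverseʳ (i , j) | δ-refl (to (i , j)) | δ-refl i | δ-refl j = refl
  ... | no k≢ρij rewrite δ-≢ k≢ρij with i ℕ.≟ proj₁ (from k) | j ℕ.≟ proj₂ (from k)
  ...   | yes i≡ | yes j≡ = ⊥-elim (k≢ρij (sym (trans (cong₂ (λ a b → to (a , b)) i≡ j≡) (strictlyInverseˡ k))))
  ...   | no i≢  | _      rewrite δ-≢ i≢ = refl
  ...   | yes _  | no j≢  rewrite δ-≢ j≢ = sym (ℤP.*-zeroʳ (δ i (proj₁ (from k))))

  sum-reindex : ∀ u v N (g : ℕ → ℕ → ℤ) → (∀ i j → u < i ⊎ v < j → g i j ≡ + 0) →
    (∀ i j → i ≤ u → j ≤ v → to (i , j) < N) →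
    sumTo N (λ k → g (proj₁ (from k)) (proj₂ (from k))) ≡ boxSum u v g
  sum-reindex u v N g outside covered = begin
      sumTo N (λ k → g (proj₁ (from k)) (proj₂ (from k)))
    ≡⟨ sum-cong N (λ k → sym (trans (boxSum-cong u v (λ i j → cong (_* g i j) (δ-split k i j)))
                                    (boxSum-δ u v g outside (proj₁ (from k)) (proj₂ (from k))))) ⟩
      sumTo N (λ k → boxSum u v (λ i j → δ k (to (i , j)) * g i j))
    ≡⟨ sum-boxSum-swap N u v (λ k i j → δ k (to (i , j)) * g i j) ⟩
      boxSum u v (λ i j → sumTo N (λ k → δ k (to (i , j)) * g i j))
    ≡⟨ boxSum-cong< u v (λ i j i≤u j≤v → sum-δ-inside N (to (i , j)) (λ _ → g i j)
                                            (covered i j (ℕP.≤-pred i≤u) (ℕP.≤-pred j≤v))) ⟩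
      boxSum u v g
    ∎
    where open ≡-Reasoning

  module _ (mono : Monotone ρ) where

    below-earlier : ∀ n i j → i ≤ proj₁ (from n) → j ≤ proj₂ (from n) → to (i , j) ≤ n
    below-earlier n i j i≤ j≤ = subst (to (i , j) ≤_) (strictlyInverseˡ n) (mono i j _ _ i≤ j≤)

    later-not-below : ∀ n k → n < k → proj₁ (from n) < proj₁ (from k) ⊎ proj₂ (from n) < proj₂ (from k)
    later-not-below n k n<k with proj₁ (from k) ℕ.≤? proj₁ (from n) | proj₂ (from k) ℕ.≤? proj₂ (from n)
    ... | yes i≤ | yes j≤ = ⊥-elim (ℕP.<⇒≱ n<k (subst (_≤ n) (strictlyInverseˡ k) (below-earlier n _ _ i≤ j≤)))
    ... | no i≰  | _      = inj₁ (ℕP.≰⇒> i≰)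
    ... | yes _  | no j≰  = inj₂ (ℕP.≰⇒> j≰)

corollary5 : (ρ : (ℕ × ℕ) ↔ ℕ)
  → (∀ a b c′ d → a ≤ c′ → b ≤ d → Inverse.to ρ (a , b) ≤ Inverse.to ρ (c′ , d))
  → let A : ℕ → ℕ → ℤ
        A n k = c (proj₁ (Inverse.from ρ n)) (proj₂ (Inverse.from ρ n))
                  (proj₁ (Inverse.from ρ k)) (proj₂ (Inverse.from ρ k))
        x : ℕ → ℤ
        x k = + f (proj₁ (Inverse.from ρ k)) (proj₂ (Inverse.from ρ k))
        b : ℕ → ℤ
        b n = bvec (Inverse.from ρ n)
    in ((∀ n → A n n ≡ + 1) × (∀ n k → n < k → A n k ≡ + 0))
       × (∀ n N → suc n ≤ N → sumTo N (λ k → A n k * x k) ≡ b n)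
corollary5 ρ mono = (diagonal , upper) , solution
  where
  open Inverse ρ
  open Enumeration ρ
  diagonal : ∀ n → c (proj₁ (from n)) (proj₂ (from n)) (proj₁ (from n)) (proj₂ (from n)) ≡ + 1
  diagonal n = c-diag (proj₁ (from n)) (proj₂ (from n))
  upper : ∀ n k → n < k → c (proj₁ (from n)) (proj₂ (from n)) (proj₁ (from k)) (proj₂ (from k)) ≡ + 0
  upper n k n<k = c-outside _ _ _ _ (later-not-below mono n k n<k)
  solution : ∀ n N → suc n ≤ N →
    sumTo N (λ k → c (proj₁ (from n)) (proj₂ (from n)) (proj₁ (from k)) (proj₂ (from k)) * + f (proj₁ (from k)) (proj₂ (from k)))
    ≡ bvec (from n)
  solution n N n<N =
    trans (sum-reindex u v N (λ i j → c u v i j * + f i j)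
                       (λ i j out → cong (_* + f i j) (c-outside u v i j out))
                       (λ i j i≤u j≤v → ℕP.≤-<-trans (below-earlier mono n i j i≤u j≤v) n<N))
          (Target.box-identity u v)
    where
    u v : ℕ
    u = proj₁ (from n)
    v = proj₂ (from n)
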